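{- For every integer $x\ge0$, $F(4,x)=\frac{x+\epsilon_x}{4}$, where $\epsilon_x=4$ if $x\equiv0\pmod 4$, $\epsilon_x=7$ if $x\equiv1\pmod4$, $\epsilon_x=6$ if $x\equiv 2\pmod 4$, and $\epsilon_x=13$ if $x\equiv3\pmod4$.
   Context: For integers $x_1>0$, $x_2\ge0$, define a sequence by letting $x_i$ (for $i\ge3$) be the least nonnegative residue of $-x_{i-2}$ modulo $x_{i-1}$ (as long as $x_{i-1}>0$), and let $F(x_1,x_2)$ be the largest index $i$ with $x_i>0$. For example $F(8,5)=4$ (sequence $8,5,2,1,0$). -}

module Defs where

open import Data.Nat using (ℕ; zero; suc; _+_; _∸_; _<_)
open import Data.Nat.DivMod using (_%_)
open import Data.Product using (_×_; _,_; proj₁)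

-- least nonnegative residue of (-a) modulo b, for b > 0; we set it to 0 when b = 0
-- (the sequence has stopped then, so this value is never "positive").
negMod : ℕ → ℕ → ℕ
negMod a zero    = 0
negMod a (suc b) = (suc b ∸ (a % suc b)) % suc b

step : ℕ × ℕ → ℕ × ℕ
step (a , b) = (b , negMod a b)

pairs : ℕ → ℕ → ℕ → ℕ × ℕ
pairs a b zero    = (a , b)
pairs a b (suc i) = step (pairs a b i)

-- seq a b i = x_i for i ≥ 1 (x_1 = a, x_2 = b); seq a b 0 = 0 (no index 0).
-- After the first zero term, all further terms are 0.
seq : ℕ → ℕ → ℕ → ℕ
seq a b zero    = 0
seq a b (suc i) = proj₁ (pairs a b i)

IsF : ℕ → ℕ → ℕ → Set
IsF a b n = (0 < seq a b n) × (∀ i → n < i → seq a b i ≡ 0)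
  where open import Relation.Binary.PropositionalEquality using (_≡_)

eps : ℕ → ℕ
eps x with x % 4
... | 0 = 4
... | 1 = 7
... | 2 = 6
... | _ = 13

module Submission where

-- The sequence generated by (a , b) is  a  followed by the
-- sequence generated by (b , negMod a b); hence F(a , b) = 1 + F(b , negMod a b)
-- (`IsF-step`).  Since negMod a b only depends on a modulo b, the pairs
-- (a , b) and (a + b , b) have the same tail, so F(a + b , b) = F(a , b)
-- (`IsF-shift-first`).  For x = 4 + y with y > 0 we have -4 ≡ y (mod 4 + y),
-- so the sequence 4, 4 + y, y, ... continues exactly as the one from (4 , y):
--
--     F(4 , 4 + y) = 1 + F(4 + y , y) = 1 + F(4 , y).
--
-- This is the recursion x ↦ x - 4 of the theorem; since ε is 4-periodic,
-- (x + ε_x)/4 satisfies the same recursion.  The five base cases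
-- x = 0, …, 4 are computed by hand from their explicit sequences.

open import Defs
open import Data.Nat using (ℕ; _+_; zero; suc; _<_; _∸_; z≤n; s≤s)
open import Data.Nat.DivMod using (_/_; _%_; m<n⇒m%n≡m; [m+n]%n≡m%n; m/n≡1+[m∸n]/n)
open import Data.Nat.Properties using (m≤m+n; <⇒≤; ∸-monoʳ-<)
open import Data.Product using (_,_; proj₁)
open import Relation.Binary.PropositionalEquality
  using (_≡_; refl; sym; trans; cong; subst; module ≡-Reasoning)

negMod-periodic : ∀ a b → negMod (a + b) b ≡ negMod a b
negMod-periodic a zero    = refl
negMod-periodic a (suc b) =
  cong (λ r → (suc b ∸ r) % suc b) ([m+n]%n≡m%n a (suc b))

-- If 0 < a < b then -a ≡ b - a (mod b), and b - a is already reduced.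
negMod-small : ∀ a b → 0 < a → a < b → negMod a b ≡ b ∸ a
negMod-small a (suc b) 0<a a<b = begin
    (suc b ∸ a % suc b) % suc b
  ≡⟨ cong (λ r → (suc b ∸ r) % suc b) (m<n⇒m%n≡m a<b) ⟩
    (suc b ∸ a) % suc b
  ≡⟨ m<n⇒m%n≡m (∸-monoʳ-< {suc b} 0<a (<⇒≤ a<b)) ⟩
    suc b ∸ a ∎
  where open ≡-Reasoning

pairs-step : ∀ a b i → pairs a b (suc i) ≡ pairs b (negMod a b) i
pairs-step a b zero    = refl
pairs-step a b (suc i) = cong step (pairs-step a b i)

seq-step : ∀ a b i → seq a b (suc (suc i)) ≡ seq b (negMod a b) (suc i)
seq-step a b i = cong proj₁ (pairs-step a b i)

pairs-zero : ∀ i → pairs 0 0 i ≡ (0 , 0)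
pairs-zero zero    = refl
pairs-zero (suc i) = cong step (pairs-zero i)

IsF-last : ∀ c → 0 < c → IsF c 0 1
IsF-last c 0<c = 0<c , vanish
  where
  vanish : ∀ i → 1 < i → seq c 0 i ≡ 0
  vanish (suc zero)    (s≤s ())
  vanish (suc (suc i)) _ = trans (seq-step c 0 i) (cong proj₁ (pairs-zero i))

IsF-step : ∀ a b n → IsF b (negMod a b) n → IsF a b (suc n)
IsF-step a b (suc n) (pos , vanish) = subst (0 <_) (sym (seq-step a b n)) pos , vanish′
  where
  vanish′ : ∀ i → suc (suc n) < i → seq a b i ≡ 0
  vanish′ (suc zero)    (s≤s ())
  vanish′ (suc (suc i)) (s≤s lt) = trans (seq-step a b i) (vanish (suc i) lt)

IsF-same-tail : ∀ a a′ b n → 0 < a′ → negMod a b ≡ negMod a′ b → IsF a b n → IsF a′ b n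
IsF-same-tail a a′ b (suc n) 0<a′ same (pos , vanish) = pos′ n pos , vanish′
  where
  tail : ∀ i → seq a b (suc (suc i)) ≡ seq a′ b (suc (suc i))
  tail i = trans (seq-step a b i)
                 (trans (cong (λ c → seq b c (suc i)) same) (sym (seq-step a′ b i)))
  pos′ : ∀ m → 0 < seq a b (suc m) → 0 < seq a′ b (suc m)
  pos′ zero    _   = 0<a′
  pos′ (suc m) pos = subst (0 <_) (tail m) pos
  vanish′ : ∀ i → suc n < i → seq a′ b i ≡ 0
  vanish′ (suc zero)    (s≤s ())
  vanish′ (suc (suc i)) lt = trans (sym (tail i)) (vanish (suc (suc i)) lt)

IsF-shift-first : ∀ a b n → 0 < a → IsF a b n → IsF (a + b) b n
IsF-shift-first a b n (s≤s _) =
  IsF-same-tail a (a + b) b n (s≤s z≤n) (sym (negMod-periodic a b))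

-- F(4 , 4 + y) = 1 + F(4 , y) for y > 0: the sequence 4, 4 + y, y, … .
IsF-four-recursion : ∀ y n → 0 < y → IsF 4 y n → IsF 4 (4 + y) (suc n)
IsF-four-recursion y@(suc _) n _ F =
  IsF-step 4 (4 + y) n
    (subst (λ c → IsF (4 + y) c n) (sym (negMod-small 4 (4 + y) (s≤s z≤n) four<4+y))
      (IsF-shift-first 4 y n (s≤s z≤n) F))
  where
  four<4+y : 4 < 4 + y
  four<4+y = s≤s (s≤s (s≤s (s≤s (s≤s z≤n))))

eps-periodic : ∀ y → eps (4 + y) ≡ eps y
eps-periodic y = refl

claimed-recursion : ∀ y → (4 + y + eps (4 + y)) / 4 ≡ suc ((y + eps y) / 4)
claimed-recursion y = begin
    (4 + y + eps (4 + y)) / 4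
  ≡⟨ cong (λ e → (4 + y + e) / 4) (eps-periodic y) ⟩
    (4 + (y + eps y)) / 4
  ≡⟨ m/n≡1+[m∸n]/n (m≤m+n 4 (y + eps y)) ⟩
    suc ((y + eps y) / 4)
  ∎
  where open ≡-Reasoning

-- F(4 , x) = (x + ε_x)/4.  Base cases, with their sequences:
--   x = 0 : 4, 0            x = 1 : 4, 1, 0        x = 2 : 4, 2, 0
--   x = 3 : 4, 3, 2, 1, 0   x = 4 : 4, 4, 0
-- and for x = 4 + y, y > 0, the recursion F(4 , 4 + y) = 1 + F(4 , y).
lemma2p8 : (x : ℕ) → IsF 4 x ((x + eps x) / 4)
lemma2p8 0 = IsF-last 4 (s≤s z≤n)
lemma2p8 1 = IsF-step 4 1 1 (IsF-last 1 (s≤s z≤n))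
lemma2p8 2 = IsF-step 4 2 1 (IsF-last 2 (s≤s z≤n))
lemma2p8 3 = IsF-step 4 3 3 (IsF-step 3 2 2 (IsF-step 2 1 1 (IsF-last 1 (s≤s z≤n))))
lemma2p8 4 = IsF-step 4 4 1 (IsF-last 4 (s≤s z≤n))
lemma2p8 (suc (suc (suc (suc y@(suc _))))) =
  subst (IsF 4 (4 + y)) (sym (claimed-recursion y))
    (IsF-four-recursion y _ (s≤s z≤n) (lemma2p8 y))
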